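{- For every $n\geq 0$, the number of Catalan words of length $2n+1$ having exactly $n$ descents equals the Catalan number $\frac{1}{n+1}\binom{2n}{n}$.
   Context: A Catalan word of length $m\geq 1$ is a word $w_1w_2\ldots w_m$ over the non-negative integers with $w_1=0$ and $0\leq w_i\leq w_{i-1}+1$ for $i=2,\ldots,m$. A descent of a word $w_1\ldots w_m$ is an index $i$ with $w_i>w_{i+1}$. -}

module Defs where

open import Data.Nat using (ℕ; zero; suc; _+_; _≤_; _<_; _≤?_; _<?_)
open import Data.Nat.Properties using (_≟_)
open import Data.List using (List; []; _∷_; length; filter; map; concatMap; upTo)
open import Data.Product using (_×_; _,_)
open import Data.Unit using (⊤; tt)
open import Data.Empty using (⊥)
open import Relation.Nullary using (Dec; yes; no)
open import Relation.Nullary.Decidable using (_×-dec_)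
open import Relation.Binary.PropositionalEquality using (_≡_)

Steps : List ℕ → Set
Steps []          = ⊤
Steps (x ∷ [])    = ⊤
Steps (x ∷ y ∷ w) = (y ≤ suc x) × Steps (y ∷ w)

IsCatalan : List ℕ → Set
IsCatalan []      = ⊥
IsCatalan (x ∷ w) = (x ≡ 0) × Steps (x ∷ w)

steps? : (w : List ℕ) → Dec (Steps w)
steps? []          = yes tt
steps? (x ∷ [])    = yes tt
steps? (x ∷ y ∷ w) = (y ≤? suc x) ×-dec steps? (y ∷ w)

isCatalan? : (w : List ℕ) → Dec (IsCatalan w)
isCatalan? []      = no (λ ())
isCatalan? (x ∷ w) = (x ≟ 0) ×-dec steps? (x ∷ w)

isDescent : ℕ → ℕ → ℕ
isDescent x y with y <? x
... | yes _ = 1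
... | no  _ = 0

descents : List ℕ → ℕ
descents []          = 0
descents (x ∷ [])    = 0
descents (x ∷ y ∷ w) = isDescent x y + descents (y ∷ w)

wordsOver : ℕ → ℕ → List (List ℕ)
wordsOver b zero    = [] ∷ []
wordsOver b (suc m) = concatMap (λ x → map (x ∷_) (wordsOver b m)) (upTo b)

-- Every letter of a Catalan word of length m is < m, so the Catalan words
-- of length m are exactly the Catalan words among wordsOver m m.
catalanWords : ℕ → List (List ℕ)
catalanWords m = filter isCatalan? (wordsOver m m)

countCatalanDescents : ℕ → ℕ → ℕ
countCatalanDescents m d = length (filter (λ w → descents w ≟ d) (catalanWords m))

-- Each descent of a Catalan word lowers the letter by at least one and every other step raises it
-- by at most one, so a word continuing from height x with d descents among its next m letters has
-- 2d ≤ x + m. A word of length 2n + 1 with n descents is therefore extremal: every step is ±1 and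
-- the word returns to 0, i.e. it is a Dyck path of length 2n. Such walks are counted by ballot
-- numbers, and the reflection principle gives ballot(2n, 0) = C(2n, n) − C(2n, n + 1), which is
-- C(2n, n)/(n + 1) because (n + 1) C(2n, n + 1) = n C(2n, n).
module Submission where

open import Defs
open import Data.Nat using (ℕ; zero; suc; _+_; _*_; _/_; _≤_; _<_; z≤n; s≤s; z<s)
open import Data.Nat.Properties
open import Algebra.Properties.CommutativeSemigroup +-commutativeSemigroup using (interchange; x∙yz≈xz∙y)
open import Data.Nat.Combinatorics using (_C_; nCk+nC[k+1]≡[n+1]C[k+1]; nCk≡nC[n∸k]; nC1≡n)
open import Data.Nat.DivMod using (m*n/n≡m)
open import Data.Nat.ListAction using (sum)
open import Data.Nat.ListAction.Properties using (sum-++)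
open import Data.List using (List; []; _∷_; _++_; [_]; length; filter; map; concatMap; upTo)
open import Data.List.Properties using (length-++; filter-++; filter-≐; filter-none; map-++; map-cong; upTo-∷ʳ)
open import Data.List.Relation.Unary.All as All using (All; []; _∷_)
open import Data.List.Relation.Unary.All.Properties using (map⁺; concat⁺; applyUpTo⁺₂)
open import Data.Product using (_×_; _,_)
open import Data.Sum using (_⊎_; inj₁; inj₂)
open import Function using (id; _∘_)
open import Relation.Binary.Definitions using (tri<; tri≈; tri>)
open import Relation.Binary.PropositionalEquality using (_≡_; _≢_; refl; sym; trans; cong; cong₂; subst; module ≡-Reasoning)
open import Relation.Nullary using (¬_; yes; no; contradiction)
open import Relation.Nullary.Decidable using (_×-dec_)
open import Relation.Unary using (Decidable; _≐_; ∁; _∩_)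
open import Relation.Unary.Properties using (_∩?_)

count : {A : Set} {P : A → Set} → Decidable P → List A → ℕ
count P? xs = length (filter P? xs)

module _ {A : Set} {P : A → Set} (P? : Decidable P) where

  count-++ : ∀ xs ys → count P? (xs ++ ys) ≡ count P? xs + count P? ys
  count-++ xs ys = trans (cong length (filter-++ P? xs ys)) (length-++ (filter P? xs))

  count-none : ∀ {xs} → All (∁ P) xs → count P? xs ≡ 0
  count-none ¬Ps = cong length (filter-none P? ¬Ps)

  count-concatMap : {B : Set} (f : B → List A) (xs : List B) →
                    count P? (concatMap f xs) ≡ sum (map (count P? ∘ f) xs)
  count-concatMap f []       = refl
  count-concatMap f (x ∷ xs) =
    trans (count-++ (f x) (concatMap f xs)) (cong (count P? (f x) +_) (count-concatMap f xs))

  count-map : {B : Set} (f : B → A) (xs : List B) →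
              count P? (map f xs) ≡ count (P? ∘ f) xs
  count-map f []       = refl
  count-map f (x ∷ xs) with P? (f x)
  ... | yes _ = cong suc (count-map f xs)
  ... | no  _ = count-map f xs

  module _ {Q : A → Set} (Q? : Decidable Q) where

    count-≐ : P ≐ Q → ∀ xs → count P? xs ≡ count Q? xs
    count-≐ P≐Q xs = cong length (filter-≐ P? Q? P≐Q xs)

    count-filter : ∀ xs → count Q? (filter P? xs) ≡ count (P? ∩? Q?) xs
    count-filter []       = refl
    count-filter (x ∷ xs) with P? x
    ... | no  _ = count-filter xs
    ... | yes _ with Q? x
    ...   | yes _ = cong suc (count-filter xs)
    ...   | no  _ = count-filter xs

sumUpTo : (ℕ → ℕ) → ℕ → ℕ
sumUpTo g b = sum (map g (upTo b))

module _ (g : ℕ → ℕ) where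

  sumUpTo-suc : ∀ b → sumUpTo g (suc b) ≡ sumUpTo g b + g b
  sumUpTo-suc b = begin
    sum (map g (upTo (suc b)))        ≡⟨ cong (sum ∘ map g) (upTo-∷ʳ b) ⟨
    sum (map g (upTo b ++ [ b ]))     ≡⟨ cong sum (map-++ g (upTo b) [ b ]) ⟩
    sum (map g (upTo b) ++ [ g b ])   ≡⟨ sum-++ (map g (upTo b)) [ g b ] ⟩
    sumUpTo g b + (g b + 0)           ≡⟨ cong (sumUpTo g b +_) (+-identityʳ (g b)) ⟩
    sumUpTo g b + g b                 ∎
    where open ≡-Reasoning

  sumUpTo-vanishing-tail : ∀ {c b} → c ≤ b → (∀ y → c ≤ y → y < b → g y ≡ 0) →
                           sumUpTo g b ≡ sumUpTo g c
  sumUpTo-vanishing-tail {b = zero}  z≤n _ = refl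
  sumUpTo-vanishing-tail {c} {suc b} c≤1+b vanish with m≤n⇒m<n∨m≡n c≤1+b
  ... | inj₂ refl = refl
  ... | inj₁ c<1+b = begin
    sumUpTo g (suc b)  ≡⟨ sumUpTo-suc b ⟩
    sumUpTo g b + g b  ≡⟨ cong (sumUpTo g b +_) (vanish b (≤-pred c<1+b) ≤-refl) ⟩
    sumUpTo g b + 0    ≡⟨ +-identityʳ _ ⟩
    sumUpTo g b        ≡⟨ sumUpTo-vanishing-tail {c} (≤-pred c<1+b) (λ y c≤y y<b → vanish y c≤y (m<n⇒m<1+n y<b)) ⟩
    sumUpTo g c        ∎
    where open ≡-Reasoning

  sumUpTo-single : ∀ {a b} → a < b → (∀ y → y < b → y ≢ a → g y ≡ 0) → sumUpTo g b ≡ g a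
  sumUpTo-single {a} {b} a<b vanish = begin
    sumUpTo g b        ≡⟨ sumUpTo-vanishing-tail a<b (λ y a<y y<b → vanish y y<b (>⇒≢ a<y)) ⟩
    sumUpTo g (suc a)  ≡⟨ sumUpTo-suc a ⟩
    sumUpTo g a + g a  ≡⟨ cong (_+ g a) (sumUpTo-vanishing-tail z≤n (λ y _ y<a → vanish y (<-trans y<a a<b) (<⇒≢ y<a))) ⟩
    g a                ∎
    where open ≡-Reasoning

  sumUpTo-pair : ∀ {a c b} → a < c → c < b → (∀ y → y < b → y ≢ a → y ≢ c → g y ≡ 0) →
                 sumUpTo g b ≡ g a + g c
  sumUpTo-pair {a} {c} {b} a<c c<b vanish = begin
    sumUpTo g b        ≡⟨ sumUpTo-vanishing-tail c<b (λ y c<y y<b → vanish y y<b (>⇒≢ (<-trans a<c c<y)) (>⇒≢ c<y)) ⟩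
    sumUpTo g (suc c)  ≡⟨ sumUpTo-suc c ⟩
    sumUpTo g c + g c  ≡⟨ cong (_+ g c) (sumUpTo-single a<c (λ y y<c y≢a → vanish y (<-trans y<c c<b) y≢a (<⇒≢ y<c))) ⟩
    g a + g c          ∎
    where open ≡-Reasoning

wordsOver-length : ∀ b m → All (λ w → length w ≡ m) (wordsOver b m)
wordsOver-length b zero    = refl ∷ []
wordsOver-length b (suc m) =
  concat⁺ (map⁺ (applyUpTo⁺₂ id b (λ _ → map⁺ (All.map (cong suc) (wordsOver-length b m)))))

count-wordsOver-suc : ∀ {P : List ℕ → Set} (P? : Decidable P) b m →
  count P? (wordsOver b (suc m)) ≡ sumUpTo (λ y → count (λ w → P? (y ∷ w)) (wordsOver b m)) b
count-wordsOver-suc P? b m =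
  trans (count-concatMap P? (λ y → map (y ∷_) (wordsOver b m)) (upTo b))
        (cong sum (map-cong (λ y → count-map P? (y ∷_) (wordsOver b m)) (upTo b)))

isDescent-< : ∀ {x y} → y < x → isDescent x y ≡ 1
isDescent-< {x} {y} y<x with y <? x
... | yes _   = refl
... | no  y≮x = contradiction y<x y≮x

isDescent-≮ : ∀ {x y} → ¬ y < x → isDescent x y ≡ 0
isDescent-≮ {x} {y} y≮x with y <? x
... | yes y<x = contradiction y<x y≮x
... | no  _   = refl

descents-bound : ∀ x w → Steps (x ∷ w) → descents (x ∷ w) + descents (x ∷ w) ≤ x + length w
descents-bound x []      _                  = z≤n
descents-bound x (y ∷ w) (y≤1+x , steps-y∷w) with y <? x
... | yes y<x = begin
  suc e + suc e          ≡⟨ cong suc (+-suc e e) ⟩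
  suc (suc (e + e))      ≤⟨ s≤s (s≤s (descents-bound y w steps-y∷w)) ⟩
  suc (suc y + length w) ≤⟨ s≤s (+-monoˡ-≤ (length w) y<x) ⟩
  suc (x + length w)     ≡⟨ +-suc x (length w) ⟨
  x + suc (length w)     ∎
  where open ≤-Reasoning
        e = descents (y ∷ w)
... | no _ = begin
  e + e                  ≤⟨ descents-bound y w steps-y∷w ⟩
  y + length w           ≤⟨ +-monoˡ-≤ (length w) y≤1+x ⟩
  suc (x + length w)     ≡⟨ +-suc x (length w) ⟨
  x + suc (length w)     ∎
  where open ≤-Reasoning
        e = descents (y ∷ w)

StepsWithDescents : ℕ → ℕ → List ℕ → Set
StepsWithDescents x d w = Steps (x ∷ w) × descents (x ∷ w) ≡ d

stepsWithDescents? : ∀ x d → Decidable (StepsWithDescents x d)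
stepsWithDescents? x d w = steps? (x ∷ w) ×-dec (descents (x ∷ w) ≟ d)

stepsWithDescents-ascent : ∀ x d → StepsWithDescents x d ∘ (suc x ∷_) ≐ StepsWithDescents (suc x) d
stepsWithDescents-ascent x d =
  (λ {w} ((_ , steps) , eq) → steps , trans (sym (ascent w)) eq) ,
  (λ {w} (steps , eq) → (≤-refl , steps) , trans (ascent w) eq)
  where
  ascent : ∀ w → descents (x ∷ suc x ∷ w) ≡ descents (suc x ∷ w)
  ascent w = cong (_+ descents (suc x ∷ w)) (isDescent-≮ (≤⇒≯ (n≤1+n x)))

stepsWithDescents-descent : ∀ y d → StepsWithDescents (suc y) (suc d) ∘ (y ∷_) ≐ StepsWithDescents y d
stepsWithDescents-descent y d =
  (λ {w} ((_ , steps) , eq) → steps , suc-injective (trans (sym (descent w)) eq)) ,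
  (λ {w} (steps , eq) → (m≤n+m y 2 , steps) , trans (descent w) (cong suc eq))
  where
  descent : ∀ w → descents (suc y ∷ y ∷ w) ≡ suc (descents (y ∷ w))
  descent w = cong (_+ descents (y ∷ w)) (isDescent-< (n<1+n y))

extremal-step : ∀ {x d y w} → StepsWithDescents x d (y ∷ w) → d + d ≡ x + suc (length w) →
                y ≡ suc x ⊎ suc y ≡ x
extremal-step {x} {_} {y} {w} ((y≤1+x , steps) , refl) tight with <-cmp y x
... | tri> _ _ x<y = inj₁ (≤-antisym y≤1+x x<y)
... | tri≈ _ refl _ = contradiction tight (<⇒≢ flat)
  where
  e = descents (x ∷ w)
  flat : descents (x ∷ x ∷ w) + descents (x ∷ x ∷ w) < x + suc (length w)
  flat = begin-strict
    descents (x ∷ x ∷ w) + descents (x ∷ x ∷ w)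
      ≡⟨ cong (λ t → t + t) (cong (_+ e) (isDescent-≮ {x} (<-irrefl refl))) ⟩
    e + e                ≤⟨ descents-bound x w steps ⟩
    x + length w         <⟨ n<1+n _ ⟩
    suc (x + length w)   ≡⟨ +-suc x (length w) ⟨
    x + suc (length w)   ∎
    where open ≤-Reasoning
... | tri< y<x _ _ with m≤n⇒m<n∨m≡n y<x
...   | inj₂ 1+y≡x = inj₂ 1+y≡x
...   | inj₁ 1+y<x = contradiction tight (<⇒≢ steep)
  where
  e = descents (y ∷ w)
  steep : descents (x ∷ y ∷ w) + descents (x ∷ y ∷ w) < x + suc (length w)
  steep = begin-strict
    descents (x ∷ y ∷ w) + descents (x ∷ y ∷ w)
      ≡⟨ cong (λ t → t + t) (cong (_+ e) (isDescent-< y<x)) ⟩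
    suc e + suc e                ≡⟨ cong suc (+-suc e e) ⟩
    suc (suc (e + e))            ≤⟨ s≤s (s≤s (descents-bound y w steps)) ⟩
    suc (suc y) + length w       ≤⟨ +-monoˡ-≤ (length w) 1+y<x ⟩
    x + length w                 <⟨ n<1+n _ ⟩
    suc (x + length w)           ≡⟨ +-suc x (length w) ⟨
    x + suc (length w)           ∎
    where open ≤-Reasoning

-- ballot m x counts the walks with steps ±1 of length m from height x to 0 that never go below 0.
ballot : ℕ → ℕ → ℕ
ballot zero    zero    = 1
ballot zero    (suc x) = 0
ballot (suc m) zero    = ballot m 1
ballot (suc m) (suc x) = ballot m x + ballot m (suc (suc x))

count-non-extremal : ∀ {b x d y} m → d + d ≡ x + suc m → y ≢ suc x → suc y ≢ x →
                     count (λ w → stepsWithDescents? x d (y ∷ w)) (wordsOver b m) ≡ 0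
count-non-extremal {b} {x} {d} {y} m tight y≢1+x 1+y≢x =
  count-none _ (All.map impossible (wordsOver-length b m))
  where
  impossible : ∀ {w} → length w ≡ m → ¬ StepsWithDescents x d (y ∷ w)
  impossible refl S with extremal-step S tight
  ... | inj₁ y≡1+x = y≢1+x y≡1+x
  ... | inj₂ 1+y≡x = 1+y≢x 1+y≡x

count-stepsWithDescents≡ballot : ∀ {b} x m d → x + m < b → d + d ≡ x + m →
                          count (stepsWithDescents? x d) (wordsOver b m) ≡ ballot m x
count-stepsWithDescents≡ballot zero    zero    zero    _ _  = refl
count-stepsWithDescents≡ballot (suc x) zero    (suc d) _ _  = refl
count-stepsWithDescents≡ballot zero    zero    (suc d) _ ()
count-stepsWithDescents≡ballot (suc x) zero    zero    _ ()
count-stepsWithDescents≡ballot (suc x) (suc m) zero    _ ()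
count-stepsWithDescents≡ballot {b} zero (suc m) d 1+m<b tight = begin
  count (stepsWithDescents? 0 d) (wordsOver b (suc m))
    ≡⟨ count-wordsOver-suc (stepsWithDescents? 0 d) b m ⟩
  sumUpTo next b
    ≡⟨ sumUpTo-single next 1<b (λ y _ y≢1 → count-non-extremal m tight y≢1 λ ()) ⟩
  next 1
    ≡⟨ count-≐ _ (stepsWithDescents? 1 d) (stepsWithDescents-ascent 0 d) (wordsOver b m) ⟩
  count (stepsWithDescents? 1 d) (wordsOver b m)
    ≡⟨ count-stepsWithDescents≡ballot 1 m d 1+m<b tight ⟩
  ballot m 1 ∎
  where
  open ≡-Reasoning
  next : ℕ → ℕ
  next y = count (λ w → stepsWithDescents? 0 d (y ∷ w)) (wordsOver b m)
  1<b : 1 < b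
  1<b = m+n≤o⇒m≤o 2 1+m<b
count-stepsWithDescents≡ballot {b} (suc x) (suc m) (suc d) 1+x+1+m<b tight = begin
  count (stepsWithDescents? (suc x) (suc d)) (wordsOver b (suc m))
    ≡⟨ count-wordsOver-suc (stepsWithDescents? (suc x) (suc d)) b m ⟩
  sumUpTo next b
    ≡⟨ sumUpTo-pair next (m<n+m x z<s) (m+n≤o⇒m≤o (3 + x) 2+x+m<b) non-extremal ⟩
  next x + next (2 + x)
    ≡⟨ cong₂ _+_ descend ascend ⟩
  ballot m x + ballot m (2 + x) ∎
  where
  open ≡-Reasoning
  next : ℕ → ℕ
  next y = count (λ w → stepsWithDescents? (suc x) (suc d) (y ∷ w)) (wordsOver b m)
  non-extremal : ∀ y → y < b → y ≢ x → y ≢ 2 + x → next y ≡ 0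
  non-extremal y _ y≢x y≢2+x = count-non-extremal m tight y≢2+x (y≢x ∘ suc-injective)
  2+x+m<b : 2 + x + m < b
  2+x+m<b = subst (_< b) (+-suc (suc x) m) 1+x+1+m<b
  descend : next x ≡ ballot m x
  descend = trans
    (count-≐ _ (stepsWithDescents? x d) (stepsWithDescents-descent x d) (wordsOver b m))
    (count-stepsWithDescents≡ballot x m d (<-trans (n<1+n _) (<-trans (n<1+n _) 2+x+m<b))
      (suc-injective (trans (sym (+-suc d d)) (trans (suc-injective tight) (+-suc x m)))))
  ascend : next (2 + x) ≡ ballot m (2 + x)
  ascend = trans
    (count-≐ _ (stepsWithDescents? (2 + x) (suc d)) (stepsWithDescents-ascent (suc x) (suc d)) (wordsOver b m))
    (count-stepsWithDescents≡ballot (2 + x) m (suc d) 2+x+m<b (trans tight (+-suc (suc x) m)))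

[1+k]*[1+n]C[1+k]≡[1+n]*nCk : ∀ n k → suc k * (suc n C suc k) ≡ suc n * (n C k)
[1+k]*[1+n]C[1+k]≡[1+n]*nCk zero    zero    = refl
[1+k]*[1+n]C[1+k]≡[1+n]*nCk zero    (suc k) = *-zeroʳ (2 + k)
[1+k]*[1+n]C[1+k]≡[1+n]*nCk (suc n) zero    =
  trans (*-identityˡ (suc (suc n) C 1)) (trans (nC1≡n (2 + n)) (sym (*-identityʳ (2 + n))))
[1+k]*[1+n]C[1+k]≡[1+n]*nCk (suc n) (suc k) = begin
  (2 + k) * (suc (suc n) C (2 + k))
    ≡⟨ cong ((2 + k) *_) (nCk+nC[k+1]≡[n+1]C[k+1] (suc n) (suc k)) ⟨
  (2 + k) * (A + suc n C (2 + k))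
    ≡⟨ *-distribˡ-+ (2 + k) A _ ⟩
  A + (1 + k) * A + (2 + k) * (suc n C (2 + k))
    ≡⟨ cong₂ (λ u v → A + u + v) ([1+k]*[1+n]C[1+k]≡[1+n]*nCk n k) ([1+k]*[1+n]C[1+k]≡[1+n]*nCk n (suc k)) ⟩
  A + suc n * (n C k) + suc n * (n C suc k)
    ≡⟨ +-assoc A _ _ ⟩
  A + (suc n * (n C k) + suc n * (n C suc k))
    ≡⟨ cong (A +_) (*-distribˡ-+ (suc n) (n C k) _) ⟨
  A + suc n * (n C k + n C suc k)
    ≡⟨ cong (λ t → A + suc n * t) (nCk+nC[k+1]≡[n+1]C[k+1] n k) ⟩
  (2 + n) * A ∎
  where
  open ≡-Reasoning
  A = suc n C suc k

[n+1+n]C[1+n]≡[n+1+n]Cn : ∀ n → (n + suc n) C suc n ≡ (n + suc n) C n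
[n+1+n]C[1+n]≡[n+1+n]Cn n =
  trans (nCk≡nC[n∸k] (m≤n+m (suc n) n)) (cong ((n + suc n) C_) (m+n∸n≡m n (suc n)))

-- The reflection principle: a walk of length m from x to 0 has k down-steps, and the walks that go
-- below 0 correspond, by reflecting them up to their first visit of -1, to the walks from x to -2,
-- which have k + 1 down-steps.
ballot-reflection : ∀ x m k → x + m ≡ k + k → ballot m x + m C suc k ≡ m C k
ballot-reflection zero    zero    zero    _    = refl
ballot-reflection (suc x) zero    (suc k) _    = refl
ballot-reflection zero    zero    (suc k) ()
ballot-reflection (suc x) zero    zero    ()
ballot-reflection zero    (suc m) zero    ()
ballot-reflection (suc x) (suc m) zero    ()
ballot-reflection zero    (suc m) (suc k) refl = begin
  ballot m 1 + suc m C (2 + k)              ≡⟨ cong (ballot m 1 +_) (nCk+nC[k+1]≡[n+1]C[k+1] m (suc k)) ⟨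
  ballot m 1 + (m C suc k + m C (2 + k))    ≡⟨ x∙yz≈xz∙y (ballot m 1) _ _ ⟩
  ballot m 1 + m C (2 + k) + m C suc k      ≡⟨ cong (_+ m C suc k) (ballot-reflection 1 m (suc k) refl) ⟩
  m C suc k + m C suc k                     ≡⟨ cong (_+ m C suc k) ([n+1+n]C[1+n]≡[n+1+n]Cn k) ⟩
  m C k + m C suc k                         ≡⟨ nCk+nC[k+1]≡[n+1]C[k+1] m k ⟩
  suc m C suc k                             ∎
  where open ≡-Reasoning
ballot-reflection (suc x) (suc m) (suc k) 1+x+1+m≡1+k+1+k = begin
  ballot m x + ballot m (2 + x) + suc m C (2 + k)
    ≡⟨ cong (ballot m x + ballot m (2 + x) +_) (nCk+nC[k+1]≡[n+1]C[k+1] m (suc k)) ⟨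
  ballot m x + ballot m (2 + x) + (m C suc k + m C (2 + k))
    ≡⟨ interchange (ballot m x) _ _ _ ⟩
  ballot m x + m C suc k + (ballot m (2 + x) + m C (2 + k))
    ≡⟨ cong₂ _+_ (ballot-reflection x m k x+m≡k+k) (ballot-reflection (2 + x) m (suc k) 2+x+m≡1+k+1+k) ⟩
  m C k + m C suc k
    ≡⟨ nCk+nC[k+1]≡[n+1]C[k+1] m k ⟩
  suc m C suc k ∎
  where
  open ≡-Reasoning
  2+x+m≡1+k+1+k : 2 + x + m ≡ suc k + suc k
  2+x+m≡1+k+1+k = trans (cong suc (sym (+-suc x m))) 1+x+1+m≡1+k+1+k
  x+m≡k+k : x + m ≡ k + k
  x+m≡k+k = suc-injective (suc-injective (trans 2+x+m≡1+k+1+k (cong suc (+-suc k k))))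

[n+n]C[1+n]*[1+n]≡[n+n]Cn*n : ∀ n → ((n + n) C suc n) * suc n ≡ ((n + n) C n) * n
[n+n]C[1+n]*[1+n]≡[n+n]Cn*n zero    = refl
[n+n]C[1+n]*[1+n]≡[n+n]Cn*n (suc n) = begin
  (suc m C (2 + n)) * (2 + n) ≡⟨ *-comm (suc m C (2 + n)) (2 + n) ⟩
  (2 + n) * (suc m C (2 + n)) ≡⟨ [1+k]*[1+n]C[1+k]≡[1+n]*nCk m (suc n) ⟩
  suc m * (m C suc n)         ≡⟨ cong (suc m *_) ([n+1+n]C[1+n]≡[n+1+n]Cn n) ⟩
  suc m * (m C n)             ≡⟨ [1+k]*[1+n]C[1+k]≡[1+n]*nCk m n ⟨
  suc n * (suc m C suc n)     ≡⟨ *-comm (suc n) (suc m C suc n) ⟩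
  (suc m C suc n) * suc n     ∎
  where
  open ≡-Reasoning
  m = n + suc n

ballot-catalan : ∀ n → ballot (n + n) 0 * suc n ≡ (n + n) C n
ballot-catalan n = +-cancelʳ-≡ (central * n) _ _ (begin
  ballot (n + n) 0 * suc n + central * n       ≡⟨ cong (ballot (n + n) 0 * suc n +_) ([n+n]C[1+n]*[1+n]≡[n+n]Cn*n n) ⟨
  ballot (n + n) 0 * suc n + offCentre * suc n ≡⟨ *-distribʳ-+ (suc n) (ballot (n + n) 0) offCentre ⟨
  (ballot (n + n) 0 + offCentre) * suc n       ≡⟨ cong (_* suc n) (ballot-reflection 0 (n + n) n refl) ⟩
  central * suc n                              ≡⟨ *-suc central n ⟩
  central + central * n                        ∎)
  where
  open ≡-Reasoning
  central = (n + n) C n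
  offCentre = (n + n) C suc n

countCatalanDescents-suc : ∀ m d →
  countCatalanDescents (suc m) d ≡ count (stepsWithDescents? 0 d) (wordsOver (suc m) m)
countCatalanDescents-suc m d = begin
  count descents≟d (filter isCatalan? (wordsOver (suc m) (suc m)))
    ≡⟨ count-filter isCatalan? descents≟d (wordsOver (suc m) (suc m)) ⟩
  count (isCatalan? ∩? descents≟d) (wordsOver (suc m) (suc m))
    ≡⟨ count-wordsOver-suc (isCatalan? ∩? descents≟d) (suc m) m ⟩
  sumUpTo next (suc m)
    ≡⟨ sumUpTo-single next {b = suc m} z<s (λ y _ y≢0 → count-none _ (All.universal (λ _ ((y≡0 , _) , _) → y≢0 y≡0) (wordsOver (suc m) m))) ⟩
  next 0
    ≡⟨ count-≐ _ (stepsWithDescents? 0 d) starts-at-0 (wordsOver (suc m) m) ⟩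
  count (stepsWithDescents? 0 d) (wordsOver (suc m) m) ∎
  where
  open ≡-Reasoning
  descents≟d : Decidable (λ w → descents w ≡ d)
  descents≟d w = descents w ≟ d
  next : ℕ → ℕ
  next y = count (λ w → (isCatalan? ∩? descents≟d) (y ∷ w)) (wordsOver (suc m) m)
  starts-at-0 : (IsCatalan ∩ (λ w → descents w ≡ d)) ∘ (0 ∷_) ≐ StepsWithDescents 0 d
  starts-at-0 = (λ ((_ , steps) , eq) → steps , eq) , (λ (steps , eq) → (refl , steps) , eq)

corollary2 : (n : ℕ) →
    countCatalanDescents (2 * n + 1) n ≡ ((2 * n) C n) / suc n
corollary2 n = begin
  countCatalanDescents (2 * n + 1) n                        ≡⟨ cong (λ m → countCatalanDescents m n) 2n+1≡1+n+n ⟩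
  countCatalanDescents (suc (n + n)) n                      ≡⟨ countCatalanDescents-suc (n + n) n ⟩
  count (stepsWithDescents? 0 n) (wordsOver (suc (n + n)) (n + n))
    ≡⟨ count-stepsWithDescents≡ballot 0 (n + n) n (n<1+n (n + n)) refl ⟩
  ballot (n + n) 0                                          ≡⟨ m*n/n≡m (ballot (n + n) 0) (suc n) ⟨
  ballot (n + n) 0 * suc n / suc n                          ≡⟨ cong (_/ suc n) (ballot-catalan n) ⟩
  ((n + n) C n) / suc n                                     ≡⟨ cong (λ m → (m C n) / suc n) 2n≡n+n ⟨
  ((2 * n) C n) / suc n                                     ∎
  where
  open ≡-Reasoning
  2n≡n+n : 2 * n ≡ n + n
  2n≡n+n = cong (n +_) (+-identityʳ n)
  2n+1≡1+n+n : 2 * n + 1 ≡ suc (n + n)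
  2n+1≡1+n+n = trans (+-comm (2 * n) 1) (cong suc 2n≡n+n)
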